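{- Let $q\in\mathbb{N}$ and let $(\vec{H},h)$ be a $q$-coloured MINI-orientation of a graph $H$. Let $\vec{G}$ be an orientation of a graph $G$ and let $\psi$ be an out-neighbourhood injective homomorphism from $\vec{G}$ to $\vec{H}$. Then $(\vec{G},h\circ\psi)$ is a $q$-coloured MINI-orientation of $G$.
   Context: Graphs are finite and simple. A $q$-colouring of $G$ assigns colours from $\mathbb{Z}_q$ with adjacent vertices coloured differently. For an orientation $\vec{G}$ and a $q$-colouring $f$, $(\vec{G},f)$ is a $q$-coloured MINI-orientation if for every vertex $v$: (i) no out-neighbour of $v$ has the same colour as an in-neighbour of $v$; (ii) the out-neighbours of $v$ have pairwise distinct colours; (iii) all in-neighbours of $v$ have the same colour. A homomorphism of oriented graphs $\psi\colon V(\vec{G})\to V(\vec{H})$ maps arcs to arcs; it is out-neighbourhood injective if for every vertex $v$ its restriction to $N^+_{\vec{G}}(v)$ is injective (into $N^+_{\vec{H}}(\psi(v))$). -}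

module Defs where

open import Data.Nat using (ℕ)
open import Data.Fin using (Fin)
open import Data.Product using (_×_)
open import Data.Sum using (_⊎_)
open import Relation.Nullary using (¬_)
open import Relation.Binary.PropositionalEquality using (_≡_)
open import Level using (0ℓ; suc)

record Graph : Set₁ where
  field
    n     : ℕ
    Adj   : Fin n → Fin n → Set
    irrefl : ∀ v → ¬ Adj v v
    sym    : ∀ {u v} → Adj u v → Adj v u
open Graph public

record Orientation (G : Graph) : Set₁ where
  field
    Arc      : Fin (n G) → Fin (n G) → Set
    arc⇒adj  : ∀ {u v} → Arc u v → Adj G u v
    adj⇒arc  : ∀ {u v} → Adj G u v → Arc u v ⊎ Arc v u
    antisym  : ∀ {u v} → Arc u v → ¬ Arc v u
open Orientation public

-- A q-colouring (colours in ℤ_q, represented as Fin q).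
IsColouring : (q : ℕ) (G : Graph) → (Fin (n G) → Fin q) → Set
IsColouring q G f = ∀ {u v} → Adj G u v → ¬ f u ≡ f v

record IsMINI (q : ℕ) (G : Graph) (D : Orientation G) (f : Fin (n G) → Fin q) : Set where
  field
    colouring : IsColouring q G f
    out-in    : ∀ v u w → Arc D v u → Arc D w v → ¬ f u ≡ f w
    out-inj   : ∀ v u w → Arc D v u → Arc D v w → ¬ u ≡ w → ¬ f u ≡ f w
    in-same   : ∀ v u w → Arc D u v → Arc D w v → f u ≡ f w

IsHom : {G H : Graph} → Orientation G → Orientation H → (Fin (n G) → Fin (n H)) → Set
IsHom D E ψ = ∀ {u v} → Arc D u v → Arc E (ψ u) (ψ v)

OutNbhdInjective : {G H : Graph} → Orientation G → (Fin (n G) → Fin (n H)) → Set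
OutNbhdInjective D ψ = ∀ v u w → Arc D v u → Arc D v w → ψ u ≡ ψ w → u ≡ w

{-# OPTIONS --safe #-}
module Submission where

open import Defs
open import Data.Nat using (ℕ)
open import Data.Fin using (Fin)
open import Function using (_∘_)
open import Data.Sum using (inj₁; inj₂)
open import Relation.Nullary using (¬_)
open import Relation.Binary.PropositionalEquality using (_≡_)

-- Conditions (i) and (iii) and properness only look at the colours of the
-- endpoints of arcs, which ψ maps to arcs of H; condition (ii) additionally
-- needs distinct out-neighbours to stay distinct, which is exactly
-- out-neighbourhood injectivity.

module _ {G H : Graph} {D : Orientation G} {E : Orientation H}
         {ψ : Fin (n G) → Fin (n H)} (hom : IsHom D E ψ) where

  hom⇒adj : ∀ {u v} → Adj G u v → Adj H (ψ u) (ψ v)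
  hom⇒adj adj with adj⇒arc D adj
  ... | inj₁ uv = arc⇒adj E (hom uv)
  ... | inj₂ vu = Graph.sym H (arc⇒adj E (hom vu))

  colouring-∘-hom : {q : ℕ} {h : Fin (n H) → Fin q} →
    IsColouring q H h → IsColouring q G (h ∘ ψ)
  colouring-∘-hom col adj = col (hom⇒adj adj)

  distinct-∘-outNbhdInjective : OutNbhdInjective {G} {H} D ψ →
    ∀ v u w → Arc D v u → Arc D v w → ¬ u ≡ w → ¬ ψ u ≡ ψ w
  distinct-∘-outNbhdInjective inj v u w vu vw u≢w = u≢w ∘ inj v u w vu vw

  mini-∘-hom : {q : ℕ} {h : Fin (n H) → Fin q} → IsMINI q H E h →
    OutNbhdInjective {G} {H} D ψ → IsMINI q G D (h ∘ ψ)
  mini-∘-hom M inj = record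
    { colouring = colouring-∘-hom colouring
    ; out-in    = λ v u w vu wv → out-in (ψ v) (ψ u) (ψ w) (hom vu) (hom wv)
    ; out-inj   = λ v u w vu vw u≢w →
        out-inj (ψ v) (ψ u) (ψ w) (hom vu) (hom vw)
                (distinct-∘-outNbhdInjective inj v u w vu vw u≢w)
    ; in-same   = λ v u w uv wv → in-same (ψ v) (ψ u) (ψ w) (hom uv) (hom wv)
    }
    where open IsMINI M

theorem5 : (q : ℕ) (H : Graph) (E : Orientation H) (h : Fin (n H) → Fin q) →
    IsMINI q H E h →
    (G : Graph) (D : Orientation G) (ψ : Fin (n G) → Fin (n H)) →
    IsHom {G} {H} D E ψ → OutNbhdInjective {G} {H} D ψ →
    IsMINI q G D (h ∘ ψ)
theorem5 q H E h M G D ψ hom inj = mini-∘-hom hom M inj
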